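{- Let $(G=(V,E),a,b,k)$ be an instance of Closeness Ratio Improvement with $n=|V|$, $C_G(b)<C_G(a)$ and $C_{G+ab}(b)<C_{G+ab}(a)$. Let $G^*=G+S^*$ where $S^*$ is an optimal solution (a set of at most $k$ non-edges of $G$ maximizing $R_{G+S^*}(a,b)$), and assume $\max\{R_G(a,b),R_{G+ab}(a,b)\}<\frac{6}{11}\cdot R_{G^*}(a,b)$. Then $k+|N_G(a)|\ge\frac n6$.
   Context: All graphs are finite, simple, undirected, unweighted and connected. $d_G(u,v)$ is the shortest-path distance, $C_G(v)=\sum_{u\in V}d_G(u,v)$ is the closeness centrality, and $R_G(a,b)=\frac{\min(C_G(a),C_G(b))}{\max(C_G(a),C_G(b))}$ is the closeness ratio. For a set $S$ of non-edges, $G+S=(V,E\cup S)$; $G+ab$ is $G$ with edge $ab$ added. $N_G(a)$ is the open neighborhood of $a$. Closeness Ratio Improvement: given $G$, $a,b\in V$, positive integer $k$, find at most $k$ non-edges $S$ maximizing $R_{G+S}(a,b)$. -}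

module Defs where

open import Data.Nat using (ℕ; zero; suc; _+_; _*_; _≤_; _<_; _<ᵇ_; _⊓_; _⊔_)
open import Data.Bool using (Bool; true; false; _∧_; _∨_; if_then_else_; not)
open import Data.Fin using (Fin; toℕ)
open import Data.Fin.Properties using (_≟_)
open import Data.List using (List; map; allFin)
open import Data.Bool.ListAction using (or)
open import Data.Nat.ListAction using (sum)
open import Data.Product using (∃; _×_; _,_)
import Data.Nat
open import Relation.Nullary using (¬_)
open import Relation.Nullary.Decidable using (⌊_⌋)
open import Relation.Binary.PropositionalEquality using (_≡_; _≢_)

record Graph (n : ℕ) : Set where
  field
    adj    : Fin n → Fin n → Bool
    sym    : ∀ u v → adj u v ≡ adj v u
    irrefl : ∀ v → adj v v ≡ false
open Graph public

module _ {n : ℕ} where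

  reach : Graph n → ℕ → Fin n → Fin n → Bool
  reach G zero    u v = ⌊ u ≟ v ⌋
  reach G (suc k) u v =
    reach G k u v ∨ or (map (λ w → reach G k u w ∧ adj G w v) (allFin n))

  Connected : Graph n → Set
  Connected G = ∀ u v → ∃ λ k → reach G k u v ≡ true

  search : Graph n → Fin n → Fin n → ℕ → ℕ → ℕ
  search G u v i zero       = i
  search G u v i (suc fuel) = if reach G i u v then i else search G u v (suc i) fuel

  -- shortest-path distance d_G(u,v) (correct for connected graphs,
  -- where every distance is < n)
  dist : Graph n → Fin n → Fin n → ℕ
  dist G u v = search G u v 0 n

  closeness : Graph n → Fin n → ℕ
  closeness G v = sum (map (λ u → dist G u v) (allFin n))

  count : (Fin n → Bool) → ℕ
  count p = sum (map (λ u → if p u then 1 else 0) (allFin n))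

  degree : Graph n → Fin n → ℕ
  degree G a = count (adj G a)

  record NonEdgeSet (G : Graph n) : Set where
    field
      mem      : Fin n → Fin n → Bool
      mem-sym  : ∀ u v → mem u v ≡ mem v u
      mem-irr  : ∀ v → mem v v ≡ false
      mem-non  : ∀ u v → mem u v ≡ true → adj G u v ≡ false
  open NonEdgeSet public

  size : {G : Graph n} → NonEdgeSet G → ℕ
  size S = sum (map (λ u → count (λ v → (toℕ u <ᵇ toℕ v) ∧ mem S u v)) (allFin n))

  addSet : (G : Graph n) → NonEdgeSet G → Graph n
  addSet G S = record
    { adj    = λ u v → adj G u v ∨ mem S u v
    ; sym    = λ u v → cong₂' (sym G u v) (mem-sym S u v)
    ; irrefl = λ v → cong₂' (irrefl G v) (mem-irr S v)
    }
    where
      open import Relation.Binary.PropositionalEquality using (cong₂)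
      cong₂' : ∀ {x y z w : Bool} → x ≡ y → z ≡ w → (x ∨ z) ≡ (y ∨ w)
      cong₂' = cong₂ _∨_

  -- G + ab (if ab is already an edge this is G itself)
  isPair : Fin n → Fin n → Fin n → Fin n → Bool
  isPair a b u v = (⌊ u ≟ a ⌋ ∧ ⌊ v ≟ b ⌋) ∨ (⌊ u ≟ b ⌋ ∧ ⌊ v ≟ a ⌋)

  addEdge : (G : Graph n) → (a b : Fin n) → a ≢ b → Graph n
  addEdge G a b a≢b = record
    { adj    = λ u v → adj G u v ∨ isPair a b u v
    ; sym    = λ u v → cong₂ _∨_ (sym G u v) (pairSym u v)
    ; irrefl = λ v → cong₂ _∨_ (irrefl G v) (pairIrr v)
    }
    where
      open import Relation.Binary.PropositionalEquality using (cong₂; refl)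
      open import Data.Bool.Properties using (∨-comm)
      open import Relation.Nullary using (yes; no)
      open import Data.Empty using (⊥-elim)
      pairSym : ∀ u v → isPair a b u v ≡ isPair a b v u
      pairSym u v with u ≟ a | v ≟ b | u ≟ b | v ≟ a
      ... | p | q | r | s = ∨-comm (⌊ p ⌋ ∧ ⌊ q ⌋) (⌊ r ⌋ ∧ ⌊ s ⌋) ⟨trans⟩ cong₂ _∨_ (∧c r s) (∧c p q)
        where
          open import Data.Bool.Properties using (∧-comm)
          open import Relation.Binary.PropositionalEquality using () renaming (trans to _⟨trans⟩_)
          ∧c : ∀ {A B : Set} (x : Relation.Nullary.Dec A) (y : Relation.Nullary.Dec B) → (⌊ x ⌋ ∧ ⌊ y ⌋) ≡ (⌊ y ⌋ ∧ ⌊ x ⌋)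
          ∧c x y = ∧-comm ⌊ x ⌋ ⌊ y ⌋
      pairIrr : ∀ v → isPair a b v v ≡ false
      pairIrr v with v ≟ a | v ≟ b
      ... | yes refl | yes refl = ⊥-elim (a≢b refl)
      ... | yes _ | no _ = refl
      ... | no _ | yes _ = refl
      ... | no _ | no _ = refl

  ratio : Graph n → Fin n → Fin n → ℕ × ℕ
  ratio G a b = (closeness G a ⊓ closeness G b , closeness G a ⊔ closeness G b)

-- p₁/q₁ ≤ p₂/q₂ (denominators positive), by cross multiplication
_≤R_ : ℕ × ℕ → ℕ × ℕ → Set
(p₁ , q₁) ≤R (p₂ , q₂) = p₁ * q₂ ≤ p₂ * q₁

-- p₁/q₁ < (6/11) · p₂/q₂ (denominators positive), by cross multiplication
_<6/11·_ : ℕ × ℕ → ℕ × ℕ → Set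
(p₁ , q₁) <6/11· (p₂ , q₂) = 11 * p₁ * q₂ < 6 * p₂ * q₁

{-# OPTIONS --safe #-}
module Submission where

-- Write x, y for the closeness of b, a in G + ab, S, T for those in G* = G + S*,
-- D = d_G*(a,b), and W for the number of vertices whose distance to b drops when ab is
-- added (such a vertex now reaches b through a). Comparing distances vertex by vertex and
-- summing gives y + 2W ≤ x + n, n ≤ x + 1, S + W ≤ x + DW, Dn ≤ T + x + DW and
-- 2n ≤ T + k + |N_G(a)| + 2 (a has at most k + |N_G(a)| neighbours in G*, every other vertex
-- is at distance ≥ 2). If n > 6(k + |N_G(a)|) these force 12S ≤ 11T, and then either W = 0,
-- S ≤ x and 6y ≤ 11T, or W > 0 and y ≤ 2x. Both give x/y ≥ (6/11)·S/T ≥ (6/11)·R_G*(a,b),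
-- contradicting R_G+ab(a,b) = x/y < (6/11)·R_G*(a,b).

open import Defs hiding (sym)
open import Data.Bool using (Bool; true; false; T; _∧_; _∨_; if_then_else_)
open import Data.Bool.Properties using (T-∨; T-∧; T-≡; ∧-zeroʳ; ∨-zeroʳ)
open import Data.Empty using (⊥; ⊥-elim)
open import Data.Fin using (Fin; zero; suc; toℕ)
open import Data.Fin.Properties using (_≟_; toℕ-injective)
open import Data.List using (List; []; _∷_; map; allFin; length)
open import Data.List.Membership.Propositional using (_∈_; lose)
open import Data.List.Membership.Propositional.Properties using (∈-allFin)
open import Data.List.Properties using (length-tabulate; map-tabulate; map-cong)
open import Data.List.Relation.Unary.Any using (here; there; satisfied)
open import Data.List.Relation.Unary.Any.Properties using (any⁺; any⁻)
open import Data.Nat using (ℕ; zero; suc; _+_; _*_; _≤_; _<_; _<ᵇ_; _⊓_; _⊔_; _≤?_; _<?_; z≤n; s≤s; s≤s⁻¹)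
open import Data.Nat.ListAction using (sum)
open import Data.Nat.Properties hiding (_≟_)
open import Algebra.Properties.CommutativeSemigroup +-commutativeSemigroup using (interchange)
open import Algebra.Properties.CommutativeSemigroup *-commutativeSemigroup using (xy∙z≈xz∙y)
open import Data.Nat.Tactic.RingSolver using (solve)
open import Data.Product using (∃; _×_; _,_; map₂)
open import Data.Sum using (_⊎_; inj₁; inj₂)
open import Function.Base using (_∘_)
open import Function.Bundles using (Equivalence)
open import Relation.Binary.Definitions using (tri<; tri≈; tri>)
open import Relation.Binary.PropositionalEquality using (_≡_; _≢_; refl; sym; trans; cong; cong₂; subst; subst₂)
open import Relation.Nullary using (¬_; yes; no; contradiction)
open import Relation.Nullary.Decidable using (⌊_⌋; toWitness; fromWitness)

open Equivalence using (to; from)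

private variable
  n j k m : ℕ

-- Sums

module _ {A : Set} where

  sum-map-mono : ∀ {f g : A → ℕ} → (∀ x → f x ≤ g x) → ∀ xs → sum (map f xs) ≤ sum (map g xs)
  sum-map-mono f≤g []       = z≤n
  sum-map-mono f≤g (x ∷ xs) = +-mono-≤ (f≤g x) (sum-map-mono f≤g xs)

  sum-map-+ : ∀ (f g : A → ℕ) xs → sum (map (λ x → f x + g x) xs) ≡ sum (map f xs) + sum (map g xs)
  sum-map-+ f g []       = refl
  sum-map-+ f g (x ∷ xs) = trans (cong (f x + g x +_) (sum-map-+ f g xs)) (interchange (f x) (g x) _ _)

  sum-map-* : ∀ c (f : A → ℕ) xs → sum (map (λ x → c * f x) xs) ≡ c * sum (map f xs)
  sum-map-* c f []       = sym (*-zeroʳ c)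
  sum-map-* c f (x ∷ xs) = trans (cong (c * f x +_) (sum-map-* c f xs)) (sym (*-distribˡ-+ c (f x) _))

  sum-map-const : ∀ c (xs : List A) → sum (map (λ _ → c) xs) ≡ c * length xs
  sum-map-const c []       = sym (*-zeroʳ c)
  sum-map-const c (x ∷ xs) = trans (cong (c +_) (sum-map-const c xs)) (sym (*-suc c (length xs)))

  ≤-sum-map : ∀ (f : A → ℕ) {x xs} → x ∈ xs → f x ≤ sum (map f xs)
  ≤-sum-map f {xs = y ∷ xs} (here refl)  = m≤m+n (f y) _
  ≤-sum-map f {xs = y ∷ xs} (there x∈xs) = ≤-trans (≤-sum-map f x∈xs) (m≤n+m _ (f y))

ind : Bool → ℕ
ind b = if b then 1 else 0

∑ : ∀ n → (Fin n → ℕ) → ℕ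
∑ n f = sum (map f (allFin n))

syntax ∑ n (λ u → e) = ∑[ u < n ] e

∑-const : ∀ n c → ∑[ _ < n ] c ≡ c * n
∑-const n c = trans (sum-map-const c (allFin n)) (cong (c *_) (length-tabulate {n = n} (λ i → i)))

∑-suc : ∀ n (f : Fin (suc n) → ℕ) → ∑ (suc n) f ≡ f zero + ∑ n (f ∘ suc)
∑-suc n f = cong (f zero +_) (cong sum
  (trans (map-tabulate {n = n} suc f) (sym (map-tabulate {n = n} (λ i → i) (f ∘ suc)))))

count-≟ : (a : Fin n) → count (λ u → ⌊ u ≟ a ⌋) ≡ 1
count-≟ {suc n} zero    = trans (∑-suc n (λ u → ind ⌊ u ≟ zero ⌋)) (cong suc (∑-const n 0))
count-≟ {suc n} (suc a) = trans (∑-suc n (λ u → ind ⌊ u ≟ suc a ⌋))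
  (trans (cong sum (map-cong suc≟suc (allFin n))) (count-≟ a))
  where
  suc≟suc : ∀ i → ind ⌊ suc i ≟ suc a ⌋ ≡ ind ⌊ i ≟ a ⌋
  suc≟suc i with i ≟ a
  ... | yes _ = refl
  ... | no _  = refl

∑-mono-at : ∀ {f g : Fin n → ℕ} {c d} a → (∀ u → u ≢ a → f u ≤ g u) → f a + c ≤ g a + d →
            ∑ n f + c ≤ ∑ n g + d
∑-mono-at {n} {f} {g} {c} {d} a off-a at-a = begin
  ∑ n f + c                     ≡⟨ cong (∑ n f +_) (spread c) ⟨
  ∑ n f + ∑[ u < n ] (c * δ u)  ≡⟨ sum-map-+ f (λ u → c * δ u) (allFin n) ⟨
  ∑[ u < n ] (f u + c * δ u)    ≤⟨ sum-map-mono pointwise (allFin n) ⟩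
  ∑[ u < n ] (g u + d * δ u)    ≡⟨ sum-map-+ g (λ u → d * δ u) (allFin n) ⟩
  ∑ n g + ∑[ u < n ] (d * δ u)  ≡⟨ cong (∑ n g +_) (spread d) ⟩
  ∑ n g + d                     ∎
  where
  open ≤-Reasoning
  δ : Fin n → ℕ
  δ u = ind ⌊ u ≟ a ⌋
  spread : ∀ e → ∑[ u < n ] (e * δ u) ≡ e
  spread e = trans (sum-map-* e δ (allFin n)) (trans (cong (e *_) (count-≟ a)) (*-identityʳ e))
  pointwise : ∀ u → f u + c * δ u ≤ g u + d * δ u
  pointwise u with u ≟ a
  ... | yes refl rewrite *-identityʳ c | *-identityʳ d = at-a
  ... | no u≢a   rewrite *-zeroʳ c | *-zeroʳ d | +-identityʳ (f u) | +-identityʳ (g u) = off-a u u≢a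

-- Walks and distances

_⊆_ : Graph n → Graph n → Set
G ⊆ H = ∀ u v → T (adj G u v) → T (adj H u v)

⊆-addEdge : ∀ (G : Graph n) a b (a≢b : a ≢ b) → G ⊆ addEdge G a b a≢b
⊆-addEdge G a b a≢b u v e = from T-∨ (inj₁ e)

⊆-addSet : ∀ (G : Graph n) (S : NonEdgeSet G) → G ⊆ addSet G S
⊆-addSet G S u v e = from T-∨ (inj₁ e)

module _ (G : Graph n) where

  reach-zero⁻ : ∀ {u v} → T (reach G 0 u v) → u ≡ v
  reach-zero⁻ = toWitness

  reach-suc : ∀ k {u v} → T (reach G k u v) → T (reach G (suc k) u v)
  reach-suc _ r = from T-∨ (inj₁ r)

  reach-step : ∀ k {u w v} → T (reach G k u w) → T (adj G w v) → T (reach G (suc k) u v)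
  reach-step _ {w = w} r e = from T-∨ (inj₂ (any⁺ _ (lose (∈-allFin w) (from T-∧ (r , e)))))

  reach-split : ∀ k {u v} → T (reach G (suc k) u v) →
                T (reach G k u v) ⊎ ∃ λ w → T (reach G k u w) × T (adj G w v)
  reach-split _ r with to T-∨ r
  ... | inj₁ r′   = inj₁ r′
  ... | inj₂ some = inj₂ (map₂ (to T-∧) (satisfied (any⁻ _ (allFin n) some)))

  reach-refl : ∀ k u → T (reach G k u u)
  reach-refl zero    u = fromWitness refl
  reach-refl (suc k) u = reach-suc k (reach-refl k u)

  reach-mono : ∀ {u v} → k ≤ m → T (reach G k u v) → T (reach G m u v)
  reach-mono {m = zero}  z≤n   r = r
  reach-mono {m = suc m} k≤1+m r with m≤n⇒m<n∨m≡n k≤1+m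
  ... | inj₁ k<1+m = reach-suc m (reach-mono (s≤s⁻¹ k<1+m) r)
  ... | inj₂ refl  = r

  reach-+ : ∀ i j {u v w} → T (reach G i u v) → T (reach G j v w) → T (reach G (i + j) u w)
  reach-+ i zero    r s with refl ← reach-zero⁻ s rewrite +-identityʳ i = r
  reach-+ i (suc j) r s rewrite +-suc i j with reach-split j s
  ... | inj₁ s′           = reach-suc (i + j) (reach-+ i j r s′)
  ... | inj₂ (_ , s′ , e) = reach-step (i + j) (reach-+ i j r s′) e

  reach-sym : ∀ k {u v} → T (reach G k u v) → T (reach G k v u)
  reach-sym zero    r with refl ← reach-zero⁻ r = r
  reach-sym (suc k) r with reach-split k r
  ... | inj₁ r′           = reach-suc k (reach-sym k r′)
  ... | inj₂ (w , r′ , e) =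
    reach-+ 1 k (reach-step 0 (reach-refl 0 _) (subst T (Graph.sym G w _) e)) (reach-sym k r′)

reach-⊆ : ∀ {G H : Graph n} → G ⊆ H → ∀ k {u v} → T (reach G k u v) → T (reach H k u v)
reach-⊆ G⊆H zero r = r
reach-⊆ {G = G} {H} G⊆H (suc k) r with reach-split G k r
... | inj₁ r′           = reach-suc H k (reach-⊆ G⊆H k r′)
... | inj₂ (w , r′ , e) = reach-step H k (reach-⊆ G⊆H k r′) (G⊆H w _ e)

distinct⇒2≤n : {u v : Fin n} → u ≢ v → 2 ≤ n
distinct⇒2≤n {suc zero}    {zero} {zero} u≢v = contradiction refl u≢v
distinct⇒2≤n {suc (suc n)} _                 = s≤s (s≤s z≤n)

module _ (G : Graph n) where

  search-≤ : ∀ {u v} i f → search G u v i f ≤ i + f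
  search-≤ i zero = m≤m+n i 0
  search-≤ {u} {v} i (suc f) with reach G i u v
  ... | true  = m≤m+n i (suc f)
  ... | false = subst (search G u v (suc i) f ≤_) (sym (+-suc i f)) (search-≤ (suc i) f)

  search-reach : ∀ {u v} i f → search G u v i f < i + f → T (reach G (search G u v i f) u v)
  search-reach i zero s<i+0 = contradiction (sym (+-identityʳ i)) (<⇒≢ s<i+0)
  search-reach {u} {v} i (suc f) s<i+1+f with reach G i u v in found
  ... | true  = from T-≡ found
  ... | false = search-reach (suc i) f (subst (search G u v (suc i) f <_) (+-suc i f) s<i+1+f)

  search-least : ∀ {u v} i f → i ≤ j → T (reach G j u v) → search G u v i f ≤ j
  search-least i zero i≤j _ = i≤j
  search-least {u = u} {v = v} i (suc f) i≤j r with reach G i u v in found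
  ... | true  = i≤j
  ... | false with m≤n⇒m<n∨m≡n i≤j
  ...   | inj₁ i<j  = search-least (suc i) f i<j r
  ...   | inj₂ refl = ⊥-elim (subst T found r)

  dist≤n : ∀ u v → dist G u v ≤ n
  dist≤n u v = search-≤ 0 n

  reach-dist : ∀ {u v} → dist G u v < n → T (reach G (dist G u v) u v)
  reach-dist = search-reach 0 n

  dist-least : ∀ j {u v} → T (reach G j u v) → dist G u v ≤ j
  dist-least j = search-least 0 n z≤n

  reach-at : ∀ m {u v} → m < n → dist G u v ≤ m → T (reach G m u v)
  reach-at m m<n d≤m = reach-mono G d≤m (reach-dist (≤-<-trans d≤m m<n))

  dist-triangle : ∀ u v w → dist G u w ≤ dist G u v + dist G v w
  dist-triangle u v w with dist G u v <? n | dist G v w <? n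
  ... | yes uv<n | yes vw<n = dist-least (dist G u v + dist G v w)
                                (reach-+ G (dist G u v) (dist G v w) (reach-dist uv<n) (reach-dist vw<n))
  ... | no uv≮n  | _        = ≤-trans (dist≤n u w) (≤-trans (≮⇒≥ uv≮n) (m≤m+n _ _))
  ... | _        | no vw≮n  = ≤-trans (dist≤n u w) (≤-trans (≮⇒≥ vw≮n) (m≤n+m _ _))

  dist≤1 : ∀ {u v} → T (adj G u v) → dist G u v ≤ 1
  dist≤1 {u} e = dist-least 1 (reach-step G 0 (reach-refl G 0 u) e)

  1≤dist : ∀ {u v} → u ≢ v → 1 ≤ dist G u v
  1≤dist u≢v = ≮⇒≥ λ d<1 →
    u≢v (reach-zero⁻ G (reach-at 0 (≤-trans (s≤s z≤n) (distinct⇒2≤n u≢v)) (≤-pred d<1)))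

  2≤dist : ∀ {u v} → u ≢ v → ¬ T (adj G u v) → 2 ≤ dist G u v
  2≤dist {u} {v} u≢v ¬adj = ≮⇒≥ λ d<2 →
    one-step (reach-split G 0 (reach-at 1 (distinct⇒2≤n u≢v) (≤-pred d<2)))
    where
    one-step : T (reach G 0 u v) ⊎ ∃ (λ w → T (reach G 0 u w) × T (adj G w v)) → ⊥
    one-step (inj₁ r)           = u≢v (reach-zero⁻ G r)
    one-step (inj₂ (w , r , e)) with refl ← reach-zero⁻ G r = ¬adj e

dist-≤-transfer : ∀ {G H : Graph n} {u v u′ v′} →
                  (∀ k → T (reach G k u v) → T (reach H k u′ v′)) → dist H u′ v′ ≤ dist G u v
dist-≤-transfer {n} {G} {H} {u} {v} {u′} {v′} transfer with dist G u v <? n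
... | yes d<n = dist-least H (dist G u v) (transfer (dist G u v) (reach-dist G d<n))
... | no d≮n  = ≤-trans (dist≤n H u′ v′) (≮⇒≥ d≮n)

dist-sym : ∀ (G : Graph n) u v → dist G u v ≡ dist G v u
dist-sym G u v =
  ≤-antisym (dist-≤-transfer (λ k → reach-sym G k)) (dist-≤-transfer (λ k → reach-sym G k))

dist-⊆ : ∀ {G H : Graph n} → G ⊆ H → ∀ u v → dist H u v ≤ dist G u v
dist-⊆ G⊆H u v = dist-≤-transfer (λ k → reach-⊆ G⊆H k)

-- Closeness and degree

module _ (G : Graph n) where

  n≤closeness+1 : ∀ b → n ≤ closeness G b + 1
  n≤closeness+1 b = begin
    n                 ≡⟨ *-identityˡ n ⟨
    1 * n             ≡⟨ ∑-const n 1 ⟨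
    ∑[ _ < n ] 1      ≡⟨ +-identityʳ _ ⟨
    ∑[ _ < n ] 1 + 0  ≤⟨ ∑-mono-at b (λ u u≢b → 1≤dist G u≢b) (m≤n+m 1 (dist G b b)) ⟩
    closeness G b + 1 ∎
    where open ≤-Reasoning

  2n≤closeness+degree+2 : ∀ a → 2 * n ≤ closeness G a + degree G a + 2
  2n≤closeness+degree+2 a = begin
    2 * n                                          ≡⟨ ∑-const n 2 ⟨
    ∑[ _ < n ] 2                                   ≡⟨ +-identityʳ _ ⟨
    ∑[ _ < n ] 2 + 0                               ≤⟨ ∑-mono-at a off-a (m≤n+m 2 _) ⟩
    ∑[ u < n ] (dist G u a + ind (adj G a u)) + 2  ≡⟨ cong (_+ 2) (sum-map-+ _ _ (allFin n)) ⟩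
    closeness G a + degree G a + 2                 ∎
    where
    open ≤-Reasoning
    off-a : ∀ u → u ≢ a → 2 ≤ dist G u a + ind (adj G a u)
    off-a u u≢a with adj G a u in a~u
    ... | true  = +-monoˡ-≤ 1 (1≤dist G u≢a)
    ... | false = ≤-trans (2≤dist G u≢a (subst T (trans (Graph.sym G u a) a~u))) (m≤m+n _ 0)

count-mem≤size : ∀ {G : Graph n} (S : NonEdgeSet G) a → count (mem S a) ≤ size S
count-mem≤size {n} S a = begin
  count (mem S a)               ≤⟨ sum-map-mono pair (allFin n) ⟩
  ∑[ v < n ] (R a v + R v a)    ≡⟨ sum-map-+ (R a) (λ v → R v a) (allFin n) ⟩
  ∑ n (R a) + ∑[ v < n ] R v a  ≡⟨ +-comm (∑ n (R a)) _ ⟩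
  ∑[ v < n ] R v a + ∑ n (R a)  ≤⟨ ∑-mono-at a (λ v _ → ≤-sum-map (R v) (∈-allFin a)) R-irrefl ⟩
  ∑[ u < n ] ∑ n (R u) + 0      ≡⟨ +-identityʳ _ ⟩
  size S                        ∎
  where
  open ≤-Reasoning
  R : Fin n → Fin n → ℕ
  R u v = ind ((toℕ u <ᵇ toℕ v) ∧ mem S u v)
  R-irrefl : R a a + ∑ n (R a) ≤ ∑ n (R a) + 0
  R-irrefl rewrite mem-irr S a | ∧-zeroʳ (toℕ a <ᵇ toℕ a) | +-identityʳ (∑ n (R a)) = ≤-refl
  pair : ∀ v → ind (mem S a v) ≤ R a v + R v a
  pair v with mem S a v in a~v
  ... | false = z≤n
  ... | true with <-cmp (toℕ a) (toℕ v)
  ...   | tri< a<v _ _ rewrite to T-≡ (<⇒<ᵇ a<v) = s≤s z≤n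
  ...   | tri≈ _ a≡v _ with refl ← toℕ-injective a≡v = contradiction (trans (sym a~v) (mem-irr S a)) λ ()
  ...   | tri> _ _ v<a rewrite to T-≡ (<⇒<ᵇ v<a) | trans (mem-sym S v a) a~v = m≤n+m 1 _

ind-∨ : ∀ x y → ind (x ∨ y) ≤ ind x + ind y
ind-∨ true  _ = s≤s z≤n
ind-∨ false _ = ≤-refl

degree-addSet : ∀ (G : Graph n) (S : NonEdgeSet G) a → degree (addSet G S) a ≤ degree G a + size S
degree-addSet {n} G S a = begin
  degree (addSet G S) a
    ≤⟨ sum-map-mono (λ u → ind-∨ (adj G a u) (mem S a u)) (allFin n) ⟩
  ∑[ u < n ] (ind (adj G a u) + ind (mem S a u))  ≡⟨ sum-map-+ _ _ (allFin n) ⟩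
  degree G a + count (mem S a)                    ≤⟨ +-monoʳ-≤ (degree G a) (count-mem≤size S a) ⟩
  degree G a + size S                             ∎
  where open ≤-Reasoning

-- Adding the edge ab

T-≟∧≟ : {u u′ v v′ : Fin n} → T (⌊ u ≟ u′ ⌋ ∧ ⌊ v ≟ v′ ⌋) → u ≡ u′ × v ≡ v′
T-≟∧≟ {u = u} {u′} {v} {v′} t with u ≟ u′ | v ≟ v′
... | yes u≡u′ | yes v≡v′ = u≡u′ , v≡v′
... | yes _    | no _     = ⊥-elim t
... | no _     | _        = ⊥-elim t

module _ (G : Graph n) (a b : Fin n) (a≢b : a ≢ b) where

  G+ab : Graph n
  G+ab = addEdge G a b a≢b

  isPair⁻ : ∀ {u v} → T (isPair a b u v) → (u ≡ a × v ≡ b) ⊎ (u ≡ b × v ≡ a)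
  isPair⁻ {u} {v} p with to (T-∨ {⌊ u ≟ a ⌋ ∧ ⌊ v ≟ b ⌋}) p
  ... | inj₁ q = inj₁ (T-≟∧≟ q)
  ... | inj₂ q = inj₂ (T-≟∧≟ q)

  ba∈G+ab : T (adj G+ab b a)
  ba∈G+ab with b ≟ b | a ≟ a
  ... | yes _  | yes _  rewrite ∨-zeroʳ (⌊ b ≟ a ⌋ ∧ ⌊ a ≟ b ⌋) | ∨-zeroʳ (adj G b a) = _
  ... | no b≢b | _      = contradiction refl b≢b
  ... | _      | no a≢a = contradiction refl a≢a

  reach-addEdge⁻ : ∀ m {u} → T (reach G+ab m b u) →
                   T (reach G m b u) ⊎ ∃ λ m′ → m ≡ suc m′ × T (reach G m′ a u)
  reach-addEdge⁻ zero r = inj₁ r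
  reach-addEdge⁻ (suc m) r with reach-split G+ab m r
  ... | inj₁ r′ with reach-addEdge⁻ m r′
  ...   | inj₁ s               = inj₁ (reach-suc G m s)
  ...   | inj₂ (m′ , refl , s) = inj₂ (m , refl , reach-suc G m′ s)
  reach-addEdge⁻ (suc m) r | inj₂ (w , r′ , e) with to T-∨ e
  ...   | inj₁ e′ with reach-addEdge⁻ m r′
  ...     | inj₁ s               = inj₁ (reach-step G m s e′)
  ...     | inj₂ (m′ , refl , s) = inj₂ (m , refl , reach-step G m′ s e′)
  reach-addEdge⁻ (suc m) {u} r | inj₂ (w , r′ , e) | inj₂ p with isPair⁻ {w} {u} p
  ...     | inj₁ (_ , refl) = inj₁ (reach-refl G (suc m) b)
  ...     | inj₂ (_ , refl) = inj₂ (m , refl , reach-refl G m a)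

  shortened : Fin n → Bool
  shortened u = ⌊ dist G+ab u b <? dist G u b ⌋

  shortened⇒via-a : ∀ u → dist G+ab u b < dist G u b → dist G u a < dist G+ab u b
  shortened⇒via-a u closer with dist G+ab u b <? n
  ... | no d≮n = contradiction (≤-trans (dist≤n G u b) (≮⇒≥ d≮n)) (<⇒≱ closer)
  ... | yes d<n with reach-addEdge⁻ (dist G+ab u b) (reach-sym G+ab (dist G+ab u b) (reach-dist G+ab d<n))
  ...   | inj₁ r = contradiction (dist-least G (dist G+ab u b) (reach-sym G (dist G+ab u b) r)) (<⇒≱ closer)
  ...   | inj₂ (m′ , eq , r) = subst (dist G u a <_) (sym eq) (s≤s (dist-least G m′ (reach-sym G m′ r)))

  closeness-a-addEdge : closeness G+ab a + 2 * count shortened ≤ closeness G+ab b + n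
  closeness-a-addEdge = begin
    closeness G+ab a + 2 * count shortened
      ≡⟨ cong (closeness G+ab a +_) (sum-map-* 2 (ind ∘ shortened) (allFin n)) ⟨
    closeness G+ab a + ∑[ u < n ] (2 * ind (shortened u))  ≡⟨ sum-map-+ _ _ (allFin n) ⟨
    ∑[ u < n ] (dist G+ab u a + 2 * ind (shortened u))     ≤⟨ sum-map-mono pointwise (allFin n) ⟩
    ∑[ u < n ] (dist G+ab u b + 1)                         ≡⟨ sum-map-+ _ _ (allFin n) ⟩
    closeness G+ab b + ∑[ _ < n ] 1                        ≡⟨ cong (closeness G+ab b +_) (∑-const n 1) ⟩
    closeness G+ab b + 1 * n                               ≡⟨ cong (closeness G+ab b +_) (*-identityˡ n) ⟩
    closeness G+ab b + n                                   ∎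
    where
    open ≤-Reasoning
    pointwise : ∀ u → dist G+ab u a + 2 * ind (shortened u) ≤ dist G+ab u b + 1
    pointwise u with dist G+ab u b <? dist G u b
    ... | yes closer = begin
      dist G+ab u a + 2     ≤⟨ +-monoˡ-≤ 2 (dist-⊆ (⊆-addEdge G a b a≢b) u a) ⟩
      dist G u a + 2        ≡⟨ +-suc (dist G u a) 1 ⟩
      suc (dist G u a) + 1  ≤⟨ +-monoˡ-≤ 1 (shortened⇒via-a u closer) ⟩
      dist G+ab u b + 1     ∎
    ... | no _ = begin
      dist G+ab u a + 0              ≡⟨ +-identityʳ _ ⟩
      dist G+ab u a                  ≤⟨ dist-triangle G+ab u b a ⟩
      dist G+ab u b + dist G+ab b a  ≤⟨ +-monoʳ-≤ (dist G+ab u b) (dist≤1 G+ab ba∈G+ab) ⟩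
      dist G+ab u b + 1              ∎

  module _ {H : Graph n} (G⊆H : G ⊆ H) where

    closeness-b-supergraph : closeness H b + count shortened ≤ closeness G+ab b + dist H a b * count shortened
    closeness-b-supergraph = begin
      closeness H b + count shortened                        ≡⟨ sum-map-+ _ _ (allFin n) ⟨
      ∑[ u < n ] (dist H u b + ind (shortened u))            ≤⟨ sum-map-mono pointwise (allFin n) ⟩
      ∑[ u < n ] (dist G+ab u b + D * ind (shortened u))     ≡⟨ sum-map-+ _ _ (allFin n) ⟩
      closeness G+ab b + ∑[ u < n ] (D * ind (shortened u))
        ≡⟨ cong (closeness G+ab b +_) (sum-map-* D (ind ∘ shortened) (allFin n)) ⟩
      closeness G+ab b + D * count shortened                 ∎
      where
      open ≤-Reasoning
      D : ℕ
      D = dist H a b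
      pointwise : ∀ u → dist H u b + ind (shortened u) ≤ dist G+ab u b + D * ind (shortened u)
      pointwise u with dist G+ab u b <? dist G u b
      ... | yes closer = begin
        dist H u b + 1         ≡⟨ +-comm _ 1 ⟩
        suc (dist H u b)       ≤⟨ s≤s (dist-triangle H u a b) ⟩
        suc (dist H u a + D)   ≤⟨ s≤s (+-monoˡ-≤ D (dist-⊆ G⊆H u a)) ⟩
        suc (dist G u a) + D   ≤⟨ +-monoˡ-≤ D (shortened⇒via-a u closer) ⟩
        dist G+ab u b + D      ≡⟨ cong (dist G+ab u b +_) (*-identityʳ D) ⟨
        dist G+ab u b + D * 1  ∎
      ... | no not-closer = begin
        dist H u b + 0         ≡⟨ +-identityʳ _ ⟩
        dist H u b             ≤⟨ dist-⊆ G⊆H u b ⟩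
        dist G u b             ≤⟨ ≮⇒≥ not-closer ⟩
        dist G+ab u b          ≡⟨ trans (cong (dist G+ab u b +_) (*-zeroʳ D)) (+-identityʳ _) ⟨
        dist G+ab u b + D * 0  ∎

    dist-ab-supergraph : dist H a b * n ≤ closeness H a + closeness G+ab b + dist H a b * count shortened
    dist-ab-supergraph = begin
      D * n                                                            ≡⟨ ∑-const n D ⟨
      ∑[ _ < n ] D                                                     ≤⟨ sum-map-mono pointwise (allFin n) ⟩
      ∑[ u < n ] (dist H u a + dist G+ab u b + D * ind (shortened u))  ≡⟨ sum-map-+ _ _ (allFin n) ⟩
      ∑[ u < n ] (dist H u a + dist G+ab u b) + ∑[ u < n ] (D * ind (shortened u))
        ≡⟨ cong₂ _+_ (sum-map-+ _ _ (allFin n)) (sum-map-* D (ind ∘ shortened) (allFin n)) ⟩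
      closeness H a + closeness G+ab b + D * count shortened           ∎
      where
      open ≤-Reasoning
      D : ℕ
      D = dist H a b
      pointwise : ∀ u → D ≤ dist H u a + dist G+ab u b + D * ind (shortened u)
      pointwise u with dist G+ab u b <? dist G u b
      ... | yes _ = begin
        D                                   ≤⟨ m≤n+m D _ ⟩
        dist H u a + dist G+ab u b + D      ≡⟨ cong (dist H u a + dist G+ab u b +_) (*-identityʳ D) ⟨
        dist H u a + dist G+ab u b + D * 1  ∎
      ... | no not-closer = begin
        D                                   ≤⟨ dist-triangle H a u b ⟩
        dist H a u + dist H u b             ≡⟨ cong (_+ dist H u b) (dist-sym H a u) ⟩
        dist H u a + dist H u b             ≤⟨ +-monoʳ-≤ (dist H u a) (dist-⊆ G⊆H u b) ⟩
        dist H u a + dist G u b             ≤⟨ +-monoʳ-≤ (dist H u a) (≮⇒≥ not-closer) ⟩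
        dist H u a + dist G+ab u b
          ≡⟨ trans (cong (dist H u a + dist G+ab u b +_) (*-zeroʳ D)) (+-identityʳ _) ⟨
        dist H u a + dist G+ab u b + D * 0  ∎

-- Linear arithmetic

-- A ≤ B follows from a nonnegative combination L ≤ R of hypotheses whenever
-- B + L = A + R + r as polynomials; each such identity is checked by the ring solver.
≤-by-combination : ∀ {A B L R} r → L ≤ R → B + L ≡ A + R + r → A ≤ B
≤-by-combination {A} {B} {L} {R} r L≤R eq = +-cancelʳ-≤ R A B (begin
  A + R      ≤⟨ m≤m+n (A + R) r ⟩
  A + R + r  ≡⟨ sym eq ⟩
  B + L      ≤⟨ +-monoʳ-≤ B L≤R ⟩
  B + R      ∎)
  where open ≤-Reasoning

infixl 6 _⊕_
_⊕_ : ∀ {a b c d} → a ≤ b → c ≤ d → a + c ≤ b + d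
_⊕_ = +-mono-≤

infixl 7 _⊛_
_⊛_ : ∀ c {a b} → a ≤ b → c * a ≤ c * b
c ⊛ a≤b = *-monoʳ-≤ c a≤b

S≤x+W⇒12S≤11T : ∀ {n x S T W} → S ≤ x + W → 5 * x + 12 * W + 1 ≤ 6 * n →
                11 * n ≤ 6 * T + 11 → 7 ≤ n → 12 * S ≤ 11 * T
S≤x+W⇒12S≤11T {n} {x} {S} {T} {W} S≤x+W x-bound T-bound 7≤n = *-cancelˡ-≤ 30
  (≤-by-combination (504 * W + 678) (360 ⊛ S≤x+W ⊕ 72 ⊛ x-bound ⊕ 55 ⊛ T-bound ⊕ 173 ⊛ 7≤n)
    (solve (n ∷ x ∷ S ∷ T ∷ W ∷ [])))

3≤D⇒12S≤11T : ∀ {n x S T W} E → S + W ≤ x + (3 + E) * W → (3 + E) * n ≤ T + x + (3 + E) * W →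
                5 * x + 12 * W + 1 ≤ 6 * n → 12 * W ≤ n + 4 → 7 ≤ n → 12 * S ≤ 11 * T
3≤D⇒12S≤11T {n} {x} {S} {T} {W} E SW≤ Dn≤ x-bound W-bound 7≤n = *-cancelˡ-≤ 5
  (≤-by-combination (26 * n + 19 + 3 * W)
    (60 ⊛ SW≤ ⊕ 55 ⊛ Dn≤ ⊕ 5 ⊛ (E ⊛ 23W≤11n) ⊕ 23 ⊛ x-bound ⊕ W-bound)
    (solve (n ∷ x ∷ S ∷ T ∷ W ∷ E ∷ [])))
  where
  23W≤11n : 23 * W ≤ 11 * n
  23W≤11n = ≤-by-combination (W + 7 * n + 6) (2 ⊛ W-bound ⊕ 2 ⊛ 7≤n) (solve (n ∷ W ∷ []))

12S≤11T : ∀ {n x S T W} D → S + W ≤ x + D * W → D * n ≤ T + x + D * W →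
          5 * x + 12 * W + 1 ≤ 6 * n → 12 * W ≤ n + 4 → 11 * n ≤ 6 * T + 11 → 7 ≤ n →
          12 * S ≤ 11 * T
12S≤11T {n} {x} {S} {T} {W} D SW≤ Dn≤ x-bound W-bound T-bound 7≤n with D ≤? 2
... | yes D≤2 = S≤x+W⇒12S≤11T {n} {x} {S} {T} {W} S≤x+W x-bound T-bound 7≤n
  where
  DW≤2W : D * W ≤ 2 * W
  DW≤2W = *-monoˡ-≤ W D≤2
  S≤x+W : S ≤ x + W
  S≤x+W = ≤-by-combination 0 (SW≤ ⊕ DW≤2W) (solve (x ∷ S ∷ W ∷ D ∷ []))
... | no D≰2 with m≤n⇒∃[o]m+o≡n (≰⇒> D≰2)
...   | E , refl = 3≤D⇒12S≤11T {n} {x} {S} {T} {W} E SW≤ Dn≤ x-bound W-bound 7≤n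

closeness-bounds⇒n≤6d : ∀ {n d x y S T D W} → 11 * x * T < 6 * S * y × 11 * x < 6 * y →
                        y + 2 * W ≤ x + n → n ≤ x + 1 → S + W ≤ x + D * W → D * n ≤ T + x + D * W →
                        2 * n ≤ T + d + 2 → 1 ≤ d → n ≤ 6 * d
closeness-bounds⇒n≤6d {n} {d} {x} {y} {S} {T} {D} {W} (xT<Sy , x<y) yW≤xn n≤x+1 SW≤ Dn≤ 2n≤ 1≤d
  with n ≤? 6 * d
... | yes n≤6d = n≤6d
... | no n≰6d  = contradiction 6Sy≤11xT (<⇒≱ xT<Sy)
  where
  6d<n : 6 * d < n
  6d<n = ≰⇒> n≰6d

  7≤n : 7 ≤ n
  7≤n = ≤-by-combination 0 (6 ⊛ 1≤d ⊕ 6d<n) (solve (n ∷ d ∷ []))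

  x-bound : 5 * x + 12 * W + 1 ≤ 6 * n
  x-bound = ≤-by-combination 0 (x<y ⊕ 6 ⊛ yW≤xn) (solve (n ∷ x ∷ y ∷ W ∷ []))

  W-bound : 12 * W ≤ n + 4
  W-bound = ≤-by-combination 0 (x-bound ⊕ 5 ⊛ n≤x+1) (solve (n ∷ x ∷ W ∷ []))

  T-bound : 11 * n ≤ 6 * T + 11
  T-bound = ≤-by-combination 0 (6 ⊛ 2n≤ ⊕ 6d<n) (solve (n ∷ d ∷ T ∷ []))

  6Sy≤11xT : 6 * S * y ≤ 11 * x * T
  6Sy≤11xT with 1 ≤? W
  ... | yes 1≤W = begin
    6 * S * y        ≤⟨ (6 * S) ⊛ y≤2x ⟩
    6 * S * (2 * x)  ≡⟨ solve (S ∷ x ∷ []) ⟩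
    12 * S * x       ≤⟨ *-monoˡ-≤ x 12S≤11T′ ⟩
    11 * T * x       ≡⟨ solve (x ∷ T ∷ []) ⟩
    11 * x * T       ∎
    where
    open ≤-Reasoning
    12S≤11T′ : 12 * S ≤ 11 * T
    12S≤11T′ = 12S≤11T {n} {x} {S} {T} {W} D SW≤ Dn≤ x-bound W-bound T-bound 7≤n
    y≤2x : y ≤ 2 * x
    y≤2x = ≤-by-combination 1 (yW≤xn ⊕ n≤x+1 ⊕ 2 ⊛ 1≤W) (solve (n ∷ x ∷ y ∷ W ∷ []))
  ... | no 1≰W = begin
    6 * S * y     ≡⟨ solve (S ∷ y ∷ []) ⟩
    S * (6 * y)   ≤⟨ *-mono-≤ S≤x 6y≤11T ⟩
    x * (11 * T)  ≡⟨ solve (x ∷ T ∷ []) ⟩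
    11 * x * T    ∎
    where
    open ≤-Reasoning
    S≤x : S ≤ x
    S≤x = ≤-by-combination W (SW≤ ⊕ D ⊛ ≤-pred (≰⇒> 1≰W)) (solve (x ∷ S ∷ D ∷ W ∷ []))
    6y≤11T : 6 * y ≤ 11 * T
    6y≤11T = *-cancelˡ-≤ 5 (≤-by-combination (T + 132 * W + 19 * n + 5)
      (30 ⊛ yW≤xn ⊕ 6 ⊛ x-bound ⊕ 9 ⊛ T-bound ⊕ 14 ⊛ 7≤n) (solve (n ∷ x ∷ y ∷ T ∷ W ∷ [])))

<6/11·-min-max : ∀ {x y S T} → x ≤ y → (y ⊓ x , y ⊔ x) <6/11· (T ⊓ S , T ⊔ S) →
                 11 * x * T < 6 * S * y × 11 * x < 6 * y
<6/11·-min-max {x} {y} {S} {T} x≤y R<R* = xT<Sy , x<y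
  where
  open ≤-Reasoning
  x[T⊔S]<[T⊓S]y : 11 * x * (T ⊔ S) < 6 * (T ⊓ S) * y
  x[T⊔S]<[T⊓S]y = subst₂ (λ p q → 11 * p * (T ⊔ S) < 6 * (T ⊓ S) * q)
                    (m≥n⇒m⊓n≡n x≤y) (m≥n⇒m⊔n≡m x≤y) R<R*
  xT<Sy : 11 * x * T < 6 * S * y
  xT<Sy = begin-strict
    11 * x * T        ≤⟨ *-monoʳ-≤ (11 * x) (m≤m⊔n T S) ⟩
    11 * x * (T ⊔ S)  <⟨ x[T⊔S]<[T⊓S]y ⟩
    6 * (T ⊓ S) * y   ≤⟨ *-monoˡ-≤ y (*-monoʳ-≤ 6 (m⊓n≤n T S)) ⟩
    6 * S * y         ∎
  x<y : 11 * x < 6 * y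
  x<y = *-cancelʳ-< (T ⊔ S) (11 * x) (6 * y) (begin-strict
    11 * x * (T ⊔ S)  <⟨ x[T⊔S]<[T⊓S]y ⟩
    6 * (T ⊓ S) * y   ≤⟨ *-monoˡ-≤ y (*-monoʳ-≤ 6 (m⊓n≤m⊔n T S)) ⟩
    6 * (T ⊔ S) * y   ≡⟨ xy∙z≈xz∙y 6 (T ⊔ S) y ⟩
    6 * y * (T ⊔ S)   ∎)

lemma4 : (n : ℕ) (G : Graph n) → Connected G → (a b : Fin n) (k : ℕ) → 1 ≤ k →
         (a≢b : a ≢ b) →
         closeness G b < closeness G a →
         closeness (addEdge G a b a≢b) b < closeness (addEdge G a b a≢b) a →
         (S* : NonEdgeSet G) → size S* ≤ k →
         (∀ (S : NonEdgeSet G) → size S ≤ k → ratio (addSet G S) a b ≤R ratio (addSet G S*) a b) →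
         ratio G a b <6/11· ratio (addSet G S*) a b →
         ratio (addEdge G a b a≢b) a b <6/11· ratio (addSet G S*) a b →
         n ≤ 6 * (k + degree G a)
lemma4 n G _ a b k 1≤k a≢b _ C′b<C′a S* |S*|≤k _ _ R′<R* =
  closeness-bounds⇒n≤6d {S = closeness G* b} {T = closeness G* a} {D = dist G* a b}
    (<6/11·-min-max (<⇒≤ C′b<C′a) R′<R*)
    (closeness-a-addEdge G a b a≢b)
    (n≤closeness+1 (addEdge G a b a≢b) b)
    (closeness-b-supergraph G a b a≢b (⊆-addSet G S*))
    (dist-ab-supergraph G a b a≢b (⊆-addSet G S*))
    2n≤T+d+2
    (≤-trans 1≤k (m≤m+n k (degree G a)))
  where
  open ≤-Reasoning
  G* : Graph n
  G* = addSet G S*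
  degree*≤k+degree : degree G* a ≤ k + degree G a
  degree*≤k+degree = begin
    degree G* a           ≤⟨ degree-addSet G S* a ⟩
    degree G a + size S*  ≤⟨ +-monoʳ-≤ (degree G a) |S*|≤k ⟩
    degree G a + k        ≡⟨ +-comm (degree G a) k ⟩
    k + degree G a        ∎
  2n≤T+d+2 : 2 * n ≤ closeness G* a + (k + degree G a) + 2
  2n≤T+d+2 = begin
    2 * n                                  ≤⟨ 2n≤closeness+degree+2 G* a ⟩
    closeness G* a + degree G* a + 2       ≤⟨ +-monoˡ-≤ 2 (+-monoʳ-≤ (closeness G* a) degree*≤k+degree) ⟩
    closeness G* a + (k + degree G a) + 2  ∎
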